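{- For all integers $n \ge 1$ and $t \ge 3$ and all $S \subseteq [t]^n$, \[ \mu(\partial S) \ge \mu(S)^{1/\eta(t)}, \qquad \eta(t) := \frac{\log t}{\log t - \log(t-1)}. \] Consequently $\eta(K_t^n) \ge \eta(t)$.
   Context: $K_t^n$ is the graph with vertex set $[t]^n = \{1,\dots,t\}^n$ in which $x,y$ are adjacent iff $x_i \neq y_i$ for all $i \in [n]$. For $S \subseteq [t]^n$, $\mu(S) := |S|/t^n$ and $\partial S := \{x \in [t]^n : \exists y \in S \text{ adjacent to } x\}$ (possibly containing points of $S$). For a finite graph $G$, $\eta(G) := \inf\{ \log \mu(S)/\log \mu(\partial S) : S \subset V_G,\ \mu(\partial S) \in (0,1)\}$, with $\log$ the natural logarithm. -}

module Defs where

open import Data.Nat using (ℕ; zero; suc; _*_; _^_; _≤_; _∸_)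
open import Data.Fin using (Fin; _≟_)
open import Data.Vec using (Vec; []; _∷_)
open import Data.List using (List; []; _∷_; map; concatMap; filterᵇ; length; allFin)
open import Data.Bool.ListAction using (any)
open import Data.Bool using (Bool; true; false; _∧_; not)
open import Relation.Nullary using (does)

Vertex : ℕ → ℕ → Set
Vertex t n = Vec (Fin t) n

vertices : (t n : ℕ) → List (Vertex t n)
vertices t zero    = [] ∷ []
vertices t (suc n) = concatMap (λ i → map (i ∷_) (vertices t n)) (allFin t)

adjacent : ∀ {t n} → Vertex t n → Vertex t n → Bool
adjacent []      []      = true
adjacent (a ∷ x) (b ∷ y) = not (does (a ≟ b)) ∧ adjacent x y

Subset : ℕ → ℕ → Set
Subset t n = Vertex t n → Bool

card : ∀ {t n} → Subset t n → ℕ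
card {t} {n} S = length (filterᵇ S (vertices t n))

boundary : ∀ {t n} → Subset t n → Subset t n
boundary {t} {n} S x = any (λ y → S y ∧ adjacent x y) (vertices t n)

-- EtaBound t N a b  encodes, exactly and in ℕ, the real inequality
--     b/N ≥ (a/N)^(1/η(t)),   η(t) = log t / (log t − log(t−1)),
-- for 0 ≤ a, 0 < b ≤ N.  Writing X = log(N/b)/log(t/(t−1)) and
-- Y = log(N/a)/log t, the inequality is X ≤ Y, i.e. every rational
-- p/q ≤ X satisfies p/q ≤ Y; and p/q ≤ X ⇔ t^p b^q ≤ (t−1)^p N^q,
-- p/q ≤ Y ⇔ t^p a^q ≤ N^q  (a = 0 makes both sides trivially true).
EtaBound : (t N a b : ℕ) → Set
EtaBound t N a b =
  ∀ (p q : ℕ) → 1 ≤ q →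
    t ^ p * b ^ q ≤ (t ∸ 1) ^ p * N ^ q →
    t ^ p * a ^ q ≤ N ^ q

-- Put w = t − 1 and, for S ⊆ [t]^n, α = |S|/t^n and β = |∂S|/t^n. The points
-- P_k = ((w/t)^k, t^(−k)) lie on the convex curve α = β^η(t); let L be their
-- piecewise-linear interpolation, with L(0) = 0. We show α ≤ L(β) by induction
-- on n. Cut S into the slices S_1, …, S_t along the first coordinate: the slice
-- of ∂S at j contains ∂S_i for every i ≠ j. If S_* has the largest boundary β_*
-- and y ≤ β_* bounds the boundaries of the other slices as well as the slice of
-- ∂S at *, then t·β ≥ w·β_* + y and t·α ≤ L(β_*) + w·L(y), and it remains to see
-- L(β_*) + w·L(y) ≤ t·L((w·β_* + y)/t). Let β_* lie in the segment
-- [(w/t)^(k+1), (w/t)^k]. If y lies there too, use that L is linear and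
-- increasing on it. Otherwise L(y) is at most the ray from the origin through
-- P_(k+1) at y, and the line through P_k, P_(k+1) at β_* plus w times that ray
-- at y is exactly t times the line through P_(k+1), P_(k+2) at (w·β_* + y)/t.
-- Since L((w/t)^p) = t^(−p), β ≤ (w/t)^p forces α ≤ t^(−p). Applied to the tensor
-- powers S^q ⊆ [t]^(qn), which satisfy |S^q| = |S|^q and |∂(S^q)| = |∂S|^q, this
-- gives the inequality for every rational exponent p/q.

{-# OPTIONS --safe #-}
module Submission where

open import Defs
open import Algebra.Bundles using (CommutativeSemiring)
import Algebra.Properties.CommutativeSemigroup as CommutativeSemigroupProperties
import Algebra.Properties.Semiring.Sum as SemiringSum
open import Data.Fin using (Fin; zero; suc; _≟_)
open import Data.List as List using (List; []; _∷_; allFin; filterᵇ; length)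
open import Data.List.Properties using (map-∘)
open import Data.Nat as ℕ using (ℕ; zero; suc)
open import Data.Vec using ([]; _∷_) renaming (_++_ to _++ᵛ_)
open import Function using (_∘_; id)
import Relation.Binary.PropositionalEquality as ≡
open ≡ using (_≡_)

module VertexSum {c ℓ} (R : CommutativeSemiring c ℓ) where

  open CommutativeSemiring R
  open SemiringSum semiring public using (sum; sum-remove; sum-cong-≗; *-distribʳ-sum)
  open SemiringSum semiring using (sum-cong-≋)
  open import Relation.Binary.Reasoning.Setoid setoid

  sumOver : {A : Set} → (A → Carrier) → List A → Carrier
  sumOver f xs = List.foldr _+_ 0# (List.map f xs)

  sumOver-cong : ∀ {A : Set} {f g : A → Carrier} → (∀ x → f x ≈ g x) → ∀ xs → sumOver f xs ≈ sumOver g xs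
  sumOver-cong f≈g []       = refl
  sumOver-cong f≈g (x ∷ xs) = +-cong (f≈g x) (sumOver-cong f≈g xs)

  sumOver-++ : ∀ {A : Set} (f : A → Carrier) xs ys →
               sumOver f (xs List.++ ys) ≈ sumOver f xs + sumOver f ys
  sumOver-++ f []       ys = sym (+-identityˡ _)
  sumOver-++ f (x ∷ xs) ys = trans (+-congˡ (sumOver-++ f xs ys)) (sym (+-assoc _ _ _))

  sumOver-concatMap : ∀ {A B : Set} (f : B → Carrier) (g : A → List B) xs →
                      sumOver f (List.concatMap g xs) ≈ sumOver (sumOver f ∘ g) xs
  sumOver-concatMap f g []       = refl
  sumOver-concatMap f g (x ∷ xs) =
    trans (sumOver-++ f (g x) (List.concatMap g xs)) (+-congˡ (sumOver-concatMap f g xs))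

  sumOver-map : ∀ {A B : Set} (f : B → Carrier) (g : A → B) xs →
                sumOver f (List.map g xs) ≡ sumOver (f ∘ g) xs
  sumOver-map f g xs = ≡.cong (List.foldr _+_ 0#) (≡.sym (map-∘ xs))

  sumOver-tabulate : ∀ {A : Set} {n} (f : A → Carrier) (g : Fin n → A) →
                     sumOver f (List.tabulate g) ≈ sum (f ∘ g)
  sumOver-tabulate {n = zero}  f g = refl
  sumOver-tabulate {n = suc n} f g = +-congˡ (sumOver-tabulate f (g ∘ suc))

  sumOver-*ˡ : ∀ {A : Set} x (f : A → Carrier) xs → sumOver (λ y → x * f y) xs ≈ x * sumOver f xs
  sumOver-*ˡ x f []       = sym (zeroʳ x)
  sumOver-*ˡ x f (y ∷ xs) = trans (+-congˡ (sumOver-*ˡ x f xs)) (sym (distribˡ x _ _))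

  sumOver-*ʳ : ∀ {A : Set} x (f : A → Carrier) xs → sumOver (λ y → f y * x) xs ≈ sumOver f xs * x
  sumOver-*ʳ x f []       = sym (zeroˡ x)
  sumOver-*ʳ x f (y ∷ xs) = trans (+-congˡ (sumOver-*ʳ x f xs)) (sym (distribʳ x _ _))

  sumOver-vertices-suc : ∀ {t n} (f : Vertex t (suc n) → Carrier) →
    sumOver f (vertices t (suc n)) ≈ sum (λ i → sumOver (f ∘ (i ∷_)) (vertices t n))
  sumOver-vertices-suc {t} {n} f = begin
    sumOver f (vertices t (suc n))
      ≈⟨ sumOver-concatMap f (λ i → List.map (i ∷_) (vertices t n)) (allFin t) ⟩
    sumOver (λ i → sumOver f (List.map (i ∷_) (vertices t n))) (allFin t)
      ≈⟨ sumOver-cong (λ i → reflexive (sumOver-map f (i ∷_) (vertices t n))) (allFin t) ⟩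
    sumOver (λ i → sumOver (f ∘ (i ∷_)) (vertices t n)) (allFin t)
      ≈⟨ sumOver-tabulate (λ i → sumOver (f ∘ (i ∷_)) (vertices t n)) id ⟩
    sum (λ i → sumOver (f ∘ (i ∷_)) (vertices t n)) ∎

  sumOver-vertices-++ : ∀ {t} m {n} (f : Vertex t (m ℕ.+ n) → Carrier) →
    sumOver f (vertices t (m ℕ.+ n)) ≈ sumOver (λ x → sumOver (f ∘ (x ++ᵛ_)) (vertices t n)) (vertices t m)
  sumOver-vertices-++         zero    f = sym (+-identityʳ _)
  sumOver-vertices-++ {t} (suc m) {n} f = begin
    sumOver f (vertices t (suc m ℕ.+ n))
      ≈⟨ sumOver-vertices-suc f ⟩
    sum (λ i → sumOver (f ∘ (i ∷_)) (vertices t (m ℕ.+ n)))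
      ≈⟨ sum-cong-≋ (λ i → sumOver-vertices-++ m (f ∘ (i ∷_))) ⟩
    sum (λ i → sumOver (λ x → sumOver (f ∘ ((i ∷ x) ++ᵛ_)) (vertices t n)) (vertices t m))
      ≈⟨ sumOver-vertices-suc (λ x → sumOver (f ∘ (x ++ᵛ_)) (vertices t n)) ⟨
    sumOver (λ x → sumOver (f ∘ (x ++ᵛ_)) (vertices t n)) (vertices t (suc m)) ∎

  sumOver-vertices-split : ∀ {t} m {n} (h : Vertex t (m ℕ.+ n) → Carrier) f g →
    (∀ x y → h (x ++ᵛ y) ≈ f x * g y) →
    sumOver h (vertices t (m ℕ.+ n)) ≈ sumOver f (vertices t m) * sumOver g (vertices t n)
  sumOver-vertices-split {t} m {n} h f g h≈f*g = begin
    sumOver h (vertices t (m ℕ.+ n))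
      ≈⟨ sumOver-vertices-++ m h ⟩
    sumOver (λ x → sumOver (h ∘ (x ++ᵛ_)) (vertices t n)) (vertices t m)
      ≈⟨ sumOver-cong (λ x → trans (sumOver-cong (h≈f*g x) (vertices t n)) (sumOver-*ˡ (f x) g (vertices t n)))
                      (vertices t m) ⟩
    sumOver (λ x → f x * sumOver g (vertices t n)) (vertices t m)
      ≈⟨ sumOver-*ʳ (sumOver g (vertices t n)) f (vertices t m) ⟩
    sumOver f (vertices t m) * sumOver g (vertices t n) ∎

open import Data.Bool using (Bool; true; false; _∧_; _∨_; not; if_then_else_)
open import Data.Bool.Properties using (∨-∧-commutativeSemiring; ∧-assoc; ∨-zeroʳ)
open import Data.Empty using (⊥-elim)
open import Data.Fin.Properties using (punchInᵢ≢i)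
open import Data.List.Extrema.Nat using (argmax; f[xs]≤f[argmax])
open import Data.List.Membership.Propositional.Properties using (∈-allFin)
import Data.List.Relation.Unary.All as All
open import Data.Nat using (_+_; _*_; _^_; _⊓_; _≤_; _<_; _≤′_; _≤?_; z≤n; s≤s; ≤′-refl; ≤′-step; >-nonZero)
open import Data.Nat.Properties hiding (_≟_)
open import Data.Nat.Tactic.RingSolver using (solve-∀)
open import Data.Product using (_×_; _,_; ∃-syntax; proj₁; proj₂)
open import Data.Sum using (_⊎_; inj₁; inj₂)
open import Data.Vec.Functional using (removeAt)
open import Relation.Nullary using (¬_; Dec; yes; no; does)
open import Relation.Nullary.Decidable using (dec-false; map′)
open import Relation.Unary using (Decidable)
open ≡ using (_≢_; refl; sym; trans; cong; cong₂; subst; subst₂; module ≡-Reasoning)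

open VertexSum +-*-commutativeSemiring
module 𝔹 = VertexSum ∨-∧-commutativeSemiring
open CommutativeSemigroupProperties (CommutativeSemiring.*-commutativeSemigroup ∨-∧-commutativeSemiring)
  using (interchange; x∙yz≈y∙xz)

sum-const : ∀ {n} {f : Fin n → ℕ} {x} → (∀ i → f i ≡ x) → sum f ≡ n * x
sum-const {zero}  f≡x = refl
sum-const {suc n} f≡x = cong₂ _+_ (f≡x zero) (sum-const (f≡x ∘ suc))

sum-≤-* : ∀ {n} {f : Fin n → ℕ} {x} → (∀ i → f i ≤ x) → sum f ≤ n * x
sum-≤-* {zero}  f≤x = z≤n
sum-≤-* {suc n} f≤x = +-mono-≤ (f≤x zero) (sum-≤-* (f≤x ∘ suc))

*-≤-sum : ∀ {n} {f : Fin n → ℕ} {x} → (∀ i → x ≤ f i) → n * x ≤ sum f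
*-≤-sum {zero}  x≤f = z≤n
*-≤-sum {suc n} x≤f = +-mono-≤ (x≤f zero) (*-≤-sum (x≤f ∘ suc))

sumOver-mono-≤ : ∀ {A : Set} {f g : A → ℕ} → (∀ x → f x ≤ g x) → ∀ xs → sumOver f xs ≤ sumOver g xs
sumOver-mono-≤ f≤g []       = z≤n
sumOver-mono-≤ f≤g (x ∷ xs) = +-mono-≤ (f≤g x) (sumOver-mono-≤ f≤g xs)

𝔹-sum-true : ∀ {n} (f : Fin n → Bool) i → f i ≡ true → 𝔹.sum f ≡ true
𝔹-sum-true f zero    fi≡true = cong (_∨ 𝔹.sum (f ∘ suc)) fi≡true
𝔹-sum-true f (suc i) fi≡true = trans (cong (f zero ∨_) (𝔹-sum-true (f ∘ suc) i fi≡true)) (∨-zeroʳ (f zero))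

indicator : Bool → ℕ
indicator b = if b then 1 else 0

indicator-∧ : ∀ a b → indicator (a ∧ b) ≡ indicator a * indicator b
indicator-∧ true  true  = refl
indicator-∧ true  false = refl
indicator-∧ false b     = refl

indicator-mono : ∀ {a b} → (a ≡ true → b ≡ true) → indicator a ≤ indicator b
indicator-mono {false} a⇒b = z≤n
indicator-mono {true}  a⇒b rewrite a⇒b refl = ≤-refl

length-filterᵇ : ∀ {A : Set} (p : A → Bool) xs → length (filterᵇ p xs) ≡ sumOver (indicator ∘ p) xs
length-filterᵇ p []       = refl
length-filterᵇ p (x ∷ xs) with p x
... | true  = cong suc (length-filterᵇ p xs)
... | false = length-filterᵇ p xs

module _ {t : ℕ} where

  _⊆_ : ∀ {n} → Subset t n → Subset t n → Set
  U ⊆ V = ∀ x → U x ≡ true → V x ≡ true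

  slice : ∀ {n} → Subset t (suc n) → Fin t → Subset t n
  slice S i x = S (i ∷ x)

  card-sumOver : ∀ {n} (S : Subset t n) → card S ≡ sumOver (indicator ∘ S) (vertices t n)
  card-sumOver {n} S = length-filterᵇ S (vertices t n)

  card-mono : ∀ {n} {U V : Subset t n} → U ⊆ V → card U ≤ card V
  card-mono {n} {U} {V} U⊆V = subst₂ _≤_ (sym (card-sumOver U)) (sym (card-sumOver V))
    (sumOver-mono-≤ (λ x → indicator-mono (U⊆V x)) (vertices t n))

  card-slices : ∀ {n} (S : Subset t (suc n)) → card S ≡ sum (λ i → card (slice S i))
  card-slices S = trans (card-sumOver S)
    (trans (sumOver-vertices-suc (indicator ∘ S)) (sum-cong-≗ (λ i → sym (card-sumOver (slice S i)))))

  card-full : ∀ {n} → card {t} {n} (λ _ → true) ≡ t ^ n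
  card-full {zero}  = refl
  card-full {suc n} = trans (card-slices {n} (λ _ → true)) (sum-const {t} (λ _ → card-full {n}))

  card≤ : ∀ {n} (U : Subset t n) → card U ≤ t ^ n
  card≤ {n} U = subst (card U ≤_) (card-full {n}) (card-mono {n} (λ _ _ → refl))

  boundary-cons : ∀ {n} (S : Subset t (suc n)) j x →
    boundary S (j ∷ x) ≡ 𝔹.sum (λ i → not (does (j ≟ i)) ∧ boundary (slice S i) x)
  boundary-cons {n} S j x = trans (𝔹.sumOver-vertices-suc (λ y → S y ∧ adjacent (j ∷ x) y))
    (𝔹.sum-cong-≗ λ i → trans
      (𝔹.sumOver-cong (λ y → x∙yz≈y∙xz (S (i ∷ y)) (not (does (j ≟ i))) (adjacent x y)) (vertices t n))
      (𝔹.sumOver-*ˡ (not (does (j ≟ i))) (λ y → S (i ∷ y) ∧ adjacent x y) (vertices t n)))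

  boundary-slice⊆ : ∀ {n} {S : Subset t (suc n)} {i j} → i ≢ j → boundary (slice S i) ⊆ slice (boundary S) j
  boundary-slice⊆ {S = S} {i} {j} i≢j x ∂Sᵢx = trans (boundary-cons S j x)
    (𝔹-sum-true _ i (cong₂ (λ a b → not a ∧ b) (dec-false (j ≟ i) (i≢j ∘ sym)) ∂Sᵢx))

  _⊗_ : ∀ {m n} → Subset t m → Subset t n → Subset t (m + n)
  _⊗_ {zero}  S R z       = S [] ∧ R z
  _⊗_ {suc m} S R (i ∷ z) = (slice S i ⊗ R) z

  ⊗-++ : ∀ {m n} {S : Subset t m} {R : Subset t n} x y → (S ⊗ R) (x ++ᵛ y) ≡ S x ∧ R y
  ⊗-++         []      y = refl
  ⊗-++ {S = S} (i ∷ x) y = ⊗-++ {S = slice S i} x y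

  adjacent-++ : ∀ {m n} (x x′ : Vertex t m) (y y′ : Vertex t n) →
                adjacent (x ++ᵛ y) (x′ ++ᵛ y′) ≡ adjacent x x′ ∧ adjacent y y′
  adjacent-++ []      []       y y′ = refl
  adjacent-++ (a ∷ x) (b ∷ x′) y y′ = trans (cong (not (does (a ≟ b)) ∧_) (adjacent-++ x x′ y y′))
                                            (sym (∧-assoc (not (does (a ≟ b))) (adjacent x x′) (adjacent y y′)))

  boundary-⊗ : ∀ {m n} (S : Subset t m) (R : Subset t n) x y →
               boundary (S ⊗ R) (x ++ᵛ y) ≡ boundary S x ∧ boundary R y
  boundary-⊗ {m} S R x y = 𝔹.sumOver-vertices-split m _ _ _ λ x′ y′ →
    trans (cong₂ _∧_ (⊗-++ x′ y′) (adjacent-++ x x′ y y′)) (interchange (S x′) (R y′) _ _)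

  card-split : ∀ {m n} (U : Subset t (m + n)) (S : Subset t m) (R : Subset t n) →
               (∀ x y → U (x ++ᵛ y) ≡ S x ∧ R y) → card U ≡ card S * card R
  card-split {m} {n} U S R U≡S∧R = begin
    card U                                                                  ≡⟨ card-sumOver U ⟩
    sumOver (indicator ∘ U) (vertices t (m + n))                            ≡⟨ sumOver-vertices-split m _ _ _ split ⟩
    sumOver (indicator ∘ S) (vertices t m) * sumOver (indicator ∘ R) (vertices t n)
                                                                            ≡⟨ cong₂ _*_ (card-sumOver S) (card-sumOver R) ⟨
    card S * card R                                                         ∎
    where
      open ≡-Reasoning
      split : ∀ x y → indicator (U (x ++ᵛ y)) ≡ indicator (S x) * indicator (R y)
      split x y = trans (cong indicator (U≡S∧R x y)) (indicator-∧ (S x) (R y))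

  _^⊗_ : ∀ {n} → Subset t n → (q : ℕ) → Subset t (q * n)
  S ^⊗ zero  = λ _ → true
  S ^⊗ suc q = S ⊗ (S ^⊗ q)

  card-^⊗ : ∀ {n} (S : Subset t n) q → card (S ^⊗ q) ≡ card S ^ q
  card-^⊗ S zero    = refl
  card-^⊗ S (suc q) = trans (card-split _ S (S ^⊗ q) ⊗-++) (cong (card S *_) (card-^⊗ S q))

  card-boundary-^⊗ : ∀ {n} (S : Subset t n) q → card (boundary (S ^⊗ q)) ≡ card (boundary S) ^ q
  card-boundary-^⊗ S zero    = refl
  card-boundary-^⊗ S (suc q) = trans (card-split _ (boundary S) (boundary (S ^⊗ q)) (boundary-⊗ S (S ^⊗ q)))
                                     (cong (card (boundary S) *_) (card-boundary-^⊗ S q))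

bernoulli : ∀ a c n → a ^ n * (a + n * c) ≤ (c + a) ^ n * a
bernoulli a c zero    = *-monoʳ-≤ 1 (≤-reflexive (+-identityʳ a))
bernoulli a c (suc n) = begin
  a * a ^ n * (a + suc n * c)                           ≡⟨ expand a c (a ^ n) n ⟩
  a * (a ^ n * (a + n * c)) + c * (a ^ n * a)
    ≤⟨ +-monoʳ-≤ (a * _) (*-monoʳ-≤ c (*-monoʳ-≤ (a ^ n) (m≤m+n a (n * c)))) ⟩
  a * (a ^ n * (a + n * c)) + c * (a ^ n * (a + n * c)) ≤⟨ +-mono-≤ (*-monoʳ-≤ a ih) (*-monoʳ-≤ c ih) ⟩
  a * ((c + a) ^ n * a) + c * ((c + a) ^ n * a)         ≡⟨ collect a c ((c + a) ^ n) ⟩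
  (c + a) * (c + a) ^ n * a                             ∎
  where
    open ≤-Reasoning
    ih : a ^ n * (a + n * c) ≤ (c + a) ^ n * a
    ih = bernoulli a c n
    expand : ∀ a c u n → a * u * (a + suc n * c) ≡ a * (u * (a + n * c)) + c * (u * a)
    expand = solve-∀
    collect : ∀ a c v → a * (v * a) + c * (v * a) ≡ (c + a) * v * a
    collect = solve-∀

crossing : ∀ {p} {P : ℕ → Set p} → Decidable P → P 0 → ∀ K → ¬ P K → ∃[ k ] P k × ¬ P (suc k)
crossing P? P0 zero    ¬PK = ⊥-elim (¬PK P0)
crossing P? P0 (suc K) ¬PK with P? K
... | yes PK   = K , PK , ¬PK
... | no  ¬PK′ = crossing P? P0 K ¬PK′

-- Read b/M as β and a/M as α. AtMost k b M and AtLeast k b M say β ≤ (w/t)^k and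
-- β ≥ (w/t)^k; Below k a b M says that (β, α) lies on or below the line through
-- P_k and P_(k+1); and a * w ^ k ≤ b says it lies below the ray from the origin
-- through P_k. UnderHull a b M is α ≤ L(β), L being the maximum of 0 and these lines.
module Hull (d : ℕ) where

  w t : ℕ
  w = suc d
  t = suc w

  data AtMost (k b M : ℕ) : Set where
    atMost : t ^ k * b ≤ w ^ k * M → AtMost k b M

  data AtLeast (k b M : ℕ) : Set where
    atLeast : w ^ k * M ≤ t ^ k * b → AtLeast k b M

  InSegment : ℕ → ℕ → ℕ → Set
  InSegment k b M = AtMost k b M × AtLeast (suc k) b M

  data Below (k a b M : ℕ) : Set where
    below : a * t ^ k * w ^ k + d * M * w ^ k ≤ w * b * t ^ k → Below k a b M

  UnderHull : ℕ → ℕ → ℕ → Set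
  UnderHull a b M = a ≡ 0 ⊎ ∃[ k ] Below k a b M

  AtMost? : ∀ k b M → Dec (AtMost k b M)
  AtMost? k b M = map′ atMost (λ { (atMost left) → left }) (t ^ k * b ≤? w ^ k * M)

  AtMost-pred : ∀ {k b M} → AtMost (suc k) b M → AtMost k b M
  AtMost-pred {k} {b} {M} (atMost left) = atMost (*-cancelˡ-≤ w (begin
    w * (t ^ k * b)  ≤⟨ *-monoˡ-≤ (t ^ k * b) (n≤1+n w) ⟩
    t * (t ^ k * b)  ≡⟨ *-assoc t (t ^ k) b ⟨
    t ^ suc k * b    ≤⟨ left ⟩
    w ^ suc k * M    ≡⟨ *-assoc w (w ^ k) M ⟩
    w * (w ^ k * M)  ∎))
    where open ≤-Reasoning

  AtMost-mono : ∀ {k b b′ M} → b′ ≤ b → AtMost k b M → AtMost k b′ M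
  AtMost-mono {k} b′≤b (atMost left) = atMost (≤-trans (*-monoʳ-≤ (t ^ k) b′≤b) left)

  AtLeast-suc : ∀ {k b M} → AtLeast k b M → AtLeast (suc k) b M
  AtLeast-suc {k} {b} {M} (atLeast right) = atLeast (begin
    w ^ suc k * M    ≡⟨ *-assoc w (w ^ k) M ⟩
    w * (w ^ k * M)  ≤⟨ *-monoʳ-≤ w right ⟩
    w * (t ^ k * b)  ≤⟨ *-monoˡ-≤ (t ^ k * b) (n≤1+n w) ⟩
    t * (t ^ k * b)  ≡⟨ *-assoc t (t ^ k) b ⟨
    t ^ suc k * b    ∎)
    where open ≤-Reasoning

  AtLeast-mono : ∀ {j k b M} → j ≤′ k → AtLeast j b M → AtLeast k b M
  AtLeast-mono ≤′-refl        = id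
  AtLeast-mono (≤′-step j≤′k) = AtLeast-suc ∘ AtLeast-mono j≤′k

  Below-mono : ∀ {k a b b′ M} → b ≤ b′ → Below k a b M → Below k a b′ M
  Below-mono {k} b≤b′ (below h) = below (≤-trans h (*-monoˡ-≤ (t ^ k) (*-monoʳ-≤ w b≤b′)))

  UnderHull-mono : ∀ {a b b′ M} → b ≤ b′ → UnderHull a b M → UnderHull a b′ M
  UnderHull-mono b≤b′ (inj₁ a≡0)     = inj₁ a≡0
  UnderHull-mono b≤b′ (inj₂ (k , h)) = inj₂ (k , Below-mono b≤b′ h)

  private
    -- With margin(k) = right side − left side of Below k a b M:
    -- margin(k + 1) = t·w·margin(k) + d·w·(w^(k+1)·M − t^(k+1)·b).
    exchange : ∀ δ a b M u v → let w = suc δ; t = suc w in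
      a * (t * u) * (w * v) + δ * M * (w * v) + (t * w * (w * b * u) + δ * w * (w * v * M))
        ≡ w * b * (t * u) + (t * w * (a * u * v + δ * M * v) + δ * w * (t * u * b))
    exchange = solve-∀

  Below-suc : ∀ {k a b M} → AtMost (suc k) b M → Below k a b M → Below (suc k) a b M
  Below-suc {k} {a} {b} {M} (atMost left) (below h) = below (+-cancelʳ-≤ Z _ _ (begin
    a * (t * u) * (w * v) + d * M * (w * v) + Z  ≡⟨ exchange d a b M u v ⟩
    w * b * (t * u) + (t * w * (a * u * v + d * M * v) + d * w * (t * u * b))
      ≤⟨ +-monoʳ-≤ (w * b * (t * u)) (+-mono-≤ (*-monoʳ-≤ (t * w) h) (*-monoʳ-≤ (d * w) left)) ⟩
    w * b * (t * u) + Z                          ∎))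
    where
      open ≤-Reasoning
      u v Z : ℕ
      u = t ^ k
      v = w ^ k
      Z = t * w * (w * b * u) + d * w * (w * v * M)

  Below-pred : ∀ {k a b M} → AtLeast (suc k) b M → Below (suc k) a b M → Below k a b M
  Below-pred {k} {a} {b} {M} (atLeast right) (below h) =
    below (*-cancelˡ-≤ (t * w) (+-cancelʳ-≤ (d * w * (t * u * b)) _ _ (+-cancelˡ-≤ (w * b * (t * u)) _ _ (begin
      w * b * (t * u) + (t * w * (a * u * v + d * M * v) + d * w * (t * u * b))             ≡⟨ exchange d a b M u v ⟨
      a * (t * u) * (w * v) + d * M * (w * v) + (t * w * (w * b * u) + d * w * (w * v * M))
        ≤⟨ +-mono-≤ h (+-monoʳ-≤ (t * w * (w * b * u)) (*-monoʳ-≤ (d * w) right)) ⟩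
      w * b * (t * u) + (t * w * (w * b * u) + d * w * (t * u * b))                          ∎))))
    where
      open ≤-Reasoning
      u v : ℕ
      u = t ^ k
      v = w ^ k

  Below-up : ∀ {m k a b M} → m ≤′ k → AtMost k b M → Below m a b M → Below k a b M
  Below-up ≤′-refl        left = id
  Below-up (≤′-step m≤′k) left = Below-suc left ∘ Below-up m≤′k (AtMost-pred left)

  Below-down : ∀ {m k a b M} → k ≤′ m → AtLeast (suc k) b M → Below m a b M → Below k a b M
  Below-down ≤′-refl        right = id
  Below-down (≤′-step k≤′m) right = Below-down k≤′m right ∘ Below-pred (AtLeast-mono (s≤′s k≤′m) right)

  Below-inSegment : ∀ {m k a b M} → InSegment k b M → Below m a b M → Below k a b M
  Below-inSegment {m} {k} (left , right) h with ≤-total m k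
  ... | inj₁ m≤k = Below-up (≤⇒≤′ m≤k) left h
  ... | inj₂ k≤m = Below-down (≤⇒≤′ k≤m) right h

  Below-zero : ∀ {k b M} → AtLeast (suc k) b M → Below k 0 b M
  Below-zero {k} {b} {M} (atLeast right) = below (*-cancelˡ-≤ t (begin
    t * (d * M * v)          ≤⟨ m≤m+n _ (v * M) ⟩
    t * (d * M * v) + v * M  ≡⟨ square d M v ⟩
    w * (w * v * M)          ≤⟨ *-monoʳ-≤ w right ⟩
    w * (t * u * b)          ≡⟨ swap t w u b ⟩
    t * (w * b * u)          ∎))
    where
      open ≤-Reasoning
      u v : ℕ
      u = t ^ k
      v = w ^ k
      square : ∀ δ M v → let w = suc δ; t = suc w in t * (δ * M * v) + v * M ≡ w * (w * v * M)
      square = solve-∀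
      swap : ∀ t w u b → w * (t * u * b) ≡ t * (w * b * u)
      swap = solve-∀

  UnderHull⇒Below : ∀ {k a b M} → InSegment k b M → UnderHull a b M → Below k a b M
  UnderHull⇒Below segment (inj₁ refl)    = Below-zero (proj₂ segment)
  UnderHull⇒Below segment (inj₂ (_ , h)) = Below-inSegment segment h

  Below⇒ray : ∀ {k a b M} → AtMost k b M → Below k a b M → a * w ^ k ≤ b
  Below⇒ray {k} {a} {b} {M} (atMost left) (below h) =
    *-cancelˡ-≤ u {{m^n≢0 t k}} (+-cancelʳ-≤ (d * (u * b)) _ _ (begin
      u * (a * v) + d * (u * b)  ≤⟨ +-monoʳ-≤ (u * (a * v)) (*-monoʳ-≤ d left) ⟩
      u * (a * v) + d * (v * M)  ≡⟨ regroup d a u v M ⟩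
      a * u * v + d * M * v      ≤⟨ h ⟩
      w * b * u                  ≡⟨ split d b u ⟩
      u * b + d * (u * b)        ∎))
    where
      open ≤-Reasoning
      u v : ℕ
      u = t ^ k
      v = w ^ k
      regroup : ∀ δ a u v M → u * (a * v) + δ * (v * M) ≡ a * u * v + δ * M * v
      regroup = solve-∀
      split : ∀ δ b u → suc δ * b * u ≡ u * b + δ * (u * b)
      split = solve-∀

  Below-suc⇒ray : ∀ {k a b M} → Below (suc k) a b M → a * w ^ k ≤ b
  Below-suc⇒ray {k} {a} {b} {M} (below h) = *-cancelˡ-≤ w (*-cancelˡ-≤ (t ^ suc k) {{m^n≢0 t (suc k)}} (begin
    t ^ suc k * (w * (a * w ^ k))                 ≡⟨ regroup (t ^ suc k) w a (w ^ k) ⟩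
    a * t ^ suc k * w ^ suc k                     ≤⟨ m≤m+n _ (d * M * w ^ suc k) ⟩
    a * t ^ suc k * w ^ suc k + d * M * w ^ suc k ≤⟨ h ⟩
    w * b * t ^ suc k                             ≡⟨ *-comm (w * b) _ ⟩
    t ^ suc k * (w * b)                           ∎))
    where
      open ≤-Reasoning
      regroup : ∀ T w a v → T * (w * (a * v)) ≡ a * T * (w * v)
      regroup = solve-∀

  UnderHull⇒ray : ∀ {j a b M} → AtMost j b M → UnderHull a b M → a * w ^ j ≤ b
  UnderHull⇒ray         left (inj₁ refl)    = z≤n
  UnderHull⇒ray {j} {a} left (inj₂ (m , h)) with ≤-<-connex m j
  ... | inj₁ m≤j        = Below⇒ray left (Below-up (≤⇒≤′ m≤j) left h)
  ... | inj₂ (s≤s j≤m′) = ≤-trans (*-monoʳ-≤ a (^-monoʳ-≤ w j≤m′)) (Below-suc⇒ray h)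

  UnderHull⇒a≡0 : ∀ {a M} → UnderHull a 0 M → a ≡ 0
  UnderHull⇒a≡0         (inj₁ a≡0)           = a≡0
  UnderHull⇒a≡0 {a} {M} (inj₂ (k , below h)) = n≤0⇒n≡0 (begin
    a                                  ≤⟨ m≤m*n a (t ^ k) {{m^n≢0 t k}} ⟩
    a * t ^ k                          ≤⟨ m≤m*n (a * t ^ k) (w ^ k) {{m^n≢0 w k}} ⟩
    a * t ^ k * w ^ k                  ≤⟨ m≤m+n _ (d * M * w ^ k) ⟩
    a * t ^ k * w ^ k + d * M * w ^ k  ≤⟨ h ⟩
    w * 0 * t ^ k                      ≡⟨ cong (_* t ^ k) (*-zeroʳ w) ⟩
    0                                  ∎)
    where open ≤-Reasoning

  w^wM*M<t^wM : ∀ M → w ^ (w * M) * M < t ^ (w * M)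
  w^wM*M<t^wM M = *-cancelˡ-< w _ _ (begin-strict
    w * (w ^ K * M)              <⟨ m<m+n (w * (w ^ K * M)) (m^n>0 w (suc K)) ⟩
    w * (w ^ K * M) + w * w ^ K  ≡⟨ regroup w (w ^ K) M ⟩
    w ^ K * (w + K * 1)          ≤⟨ bernoulli w 1 K ⟩
    t ^ K * w                    ≡⟨ *-comm (t ^ K) w ⟩
    w * t ^ K                    ∎)
    where
      open ≤-Reasoning
      K : ℕ
      K = w * M
      regroup : ∀ w v M → w * (v * M) + w * v ≡ v * (w + w * M * 1)
      regroup = solve-∀

  ¬AtMost-w*M : ∀ {b M} → 1 ≤ b → ¬ AtMost (w * M) b M
  ¬AtMost-w*M {b} {M} 1≤b (atMost left) =
    <⇒≱ (w^wM*M<t^wM M) (≤-trans (m≤m*n (t ^ (w * M)) b {{>-nonZero 1≤b}}) left)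

  find-segment : ∀ {b M} → 1 ≤ b → b ≤ M → ∃[ k ] InSegment k b M
  find-segment {b} {M} 1≤b b≤M
    with crossing (λ k → AtMost? k b M) (atMost (*-monoʳ-≤ 1 b≤M)) (w * M) (¬AtMost-w*M 1≤b)
  ... | k , left , ¬left′ = k , left , atLeast (<⇒≤ (≰⇒> (¬left′ ∘ atMost)))

  Below-+ : ∀ {k a a′ b b′ M M′} → Below k a b M → Below k a′ b′ M′ → Below k (a + a′) (b + b′) (M + M′)
  Below-+ {k} {a} {a′} {b} {b′} {M} {M′} (below h) (below h′) = below (begin
    (a + a′) * u * v + d * (M + M′) * v                  ≡⟨ split-left d a a′ M M′ u v ⟩
    (a * u * v + d * M * v) + (a′ * u * v + d * M′ * v)  ≤⟨ +-mono-≤ h h′ ⟩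
    w * b * u + w * b′ * u                               ≡⟨ split-right w b b′ u ⟨
    w * (b + b′) * u                                     ∎)
    where
      open ≤-Reasoning
      u v : ℕ
      u = t ^ k
      v = w ^ k
      split-left : ∀ δ a a′ M M′ u v →
        (a + a′) * u * v + δ * (M + M′) * v ≡ (a * u * v + δ * M * v) + (a′ * u * v + δ * M′ * v)
      split-left = solve-∀
      split-right : ∀ w b b′ u → w * (b + b′) * u ≡ w * b * u + w * b′ * u
      split-right = solve-∀

  Below-sum : ∀ {k n b M} {a : Fin n → ℕ} → (∀ i → Below k (a i) b M) → Below k (sum a) (n * b) (n * M)
  Below-sum {k} {zero}  h = below (≤-reflexive (trans (cong (_* w ^ k) (*-zeroʳ d)) (sym (cong (_* t ^ k) (*-zeroʳ w)))))
  Below-sum {n = suc n} h = Below-+ (h zero) (Below-sum (h ∘ suc))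

  Below-merge-suc : ∀ {k a₁ A b₁ y M} → Below k a₁ b₁ M → A * w ^ suc k ≤ w * y →
                    Below (suc k) (a₁ + A) (w * b₁ + y) (t * M)
  Below-merge-suc {k} {a₁} {A} {b₁} {y} {M} (below h) A-ray = below (begin
    (a₁ + A) * (t * u) * (w * v) + d * (t * M) * (w * v)      ≡⟨ split-left t w d a₁ A M u v ⟩
    t * w * (a₁ * u * v + d * M * v) + t * u * (A * (w * v))
      ≤⟨ +-mono-≤ (*-monoʳ-≤ (t * w) h) (*-monoʳ-≤ (t * u) A-ray) ⟩
    t * w * (w * b₁ * u) + t * u * (w * y)                    ≡⟨ merge-right t w b₁ y u ⟩
    w * (w * b₁ + y) * (t * u)                                ∎)
    where
      open ≤-Reasoning
      u v : ℕ
      u = t ^ k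
      v = w ^ k
      split-left : ∀ t w δ a₁ A M u v → (a₁ + A) * (t * u) * (w * v) + δ * (t * M) * (w * v)
                                        ≡ t * w * (a₁ * u * v + δ * M * v) + t * u * (A * (w * v))
      split-left = solve-∀
      merge-right : ∀ t w b₁ y u → t * w * (w * b₁ * u) + t * u * (w * y) ≡ w * (w * b₁ + y) * (t * u)
      merge-right = solve-∀

  y≤x⇒x+w*y≤w*x+y : ∀ {x y} → y ≤ x → x + w * y ≤ w * x + y
  y≤x⇒x+w*y≤w*x+y {x} {y} y≤x = begin
    x + (y + d * y)  ≤⟨ +-monoʳ-≤ x (+-monoʳ-≤ y (*-monoʳ-≤ d y≤x)) ⟩
    x + (y + d * x)  ≡⟨ regroup d x y ⟩
    w * x + y        ∎
    where
      open ≤-Reasoning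
      regroup : ∀ δ x y → x + (y + δ * x) ≡ suc δ * x + y
      regroup = solve-∀

  UnderHull-merge : ∀ {k a₁ b₁ y M} → AtMost k b₁ M → Below k a₁ b₁ M → y ≤ b₁ →
                    (a : Fin w → ℕ) → (∀ j → UnderHull (a j) y M) →
                    UnderHull (a₁ + sum a) (w * b₁ + y) (t * M)
  UnderHull-merge {k} {a₁} {b₁} {y} {M} left h y≤b₁ a hull with AtMost? (suc k) y M
  ... | yes y-left  = inj₂ (suc k , Below-merge-suc h (begin
    sum a * w ^ suc k            ≡⟨ *-distribʳ-sum (w ^ suc k) a ⟩
    sum (λ j → a j * w ^ suc k)  ≤⟨ sum-≤-* (λ j → UnderHull⇒ray y-left (hull j)) ⟩
    w * y                        ∎))
    where open ≤-Reasoning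
  ... | no  y-right = inj₂ (k , Below-mono (y≤x⇒x+w*y≤w*x+y y≤b₁)
                                  (Below-+ h (Below-sum (λ j → UnderHull⇒Below y-segment (hull j)))))
    where
      y-segment : InSegment k y M
      y-segment = AtMost-mono y≤b₁ left , atLeast (<⇒≤ (≰⇒> (y-right ∘ atMost)))

  UnderHull-step : ∀ {M} (a b c : Fin t → ℕ) → (∀ i → b i ≤ M) → (∀ i → UnderHull (a i) (b i) M) →
                   (∀ i j → i ≢ j → b i ≤ c j) → UnderHull (sum a) (sum c) (t * M)
  UnderHull-step {M} a b c b≤M hull b≤c = by-cases (1 ≤? b i*)
    where
      i* : Fin t
      i* = argmax b zero (allFin t)

      b≤b* : ∀ i → b i ≤ b i*
      b≤b* i = All.lookup (f[xs]≤f[argmax] {f = b} zero (allFin t)) (∈-allFin i)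

      y : ℕ
      y = b i* ⊓ c i*

      others : ∀ j → UnderHull (removeAt a i* j) y M
      others j = UnderHull-mono (⊓-glb (b≤b* _) (b≤c _ i* (punchInᵢ≢i i* j))) (hull _)

      c-bound : w * b i* + y ≤ sum c
      c-bound = begin
        w * b i* + y
          ≤⟨ +-mono-≤ (*-≤-sum (λ j → b≤c i* _ (punchInᵢ≢i i* j ∘ sym))) (m⊓n≤n (b i*) (c i*)) ⟩
        sum (removeAt c i*) + c i*  ≡⟨ +-comm _ (c i*) ⟩
        c i* + sum (removeAt c i*)  ≡⟨ sum-remove {i = i*} c ⟨
        sum c                       ∎
        where open ≤-Reasoning

      merge : ∃[ k ] InSegment k (b i*) M → UnderHull (sum a) (sum c) (t * M)
      merge (k , segment) = subst (λ s → UnderHull s (sum c) (t * M)) (sym (sum-remove {i = i*} a))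
        (UnderHull-mono c-bound
          (UnderHull-merge (proj₁ segment) (UnderHull⇒Below segment (hull i*)) (m⊓n≤m _ _) (removeAt a i*) others))

      by-cases : Dec (1 ≤ b i*) → UnderHull (sum a) (sum c) (t * M)
      by-cases (yes 1≤b*) = merge (find-segment 1≤b* (b≤M i*))
      by-cases (no  b*<1) = inj₁ (trans (sum-const a≡0) (*-zeroʳ t))
        where
          a≡0 : ∀ i → a i ≡ 0
          a≡0 i = UnderHull⇒a≡0 (UnderHull-mono (≤-trans (b≤b* i) (≤-pred (≰⇒> b*<1))) (hull i))

  UnderHull-card : ∀ n (S : Subset t n) → UnderHull (card S) (card (boundary S)) (t ^ n)
  UnderHull-card zero S with S []
  ... | true  = inj₂ (0 , below (≤-reflexive (P₀-on-line₀ d)))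
    where
      P₀-on-line₀ : ∀ δ → 1 * 1 * 1 + δ * 1 * 1 ≡ suc δ * 1 * 1
      P₀-on-line₀ = solve-∀
  ... | false = inj₁ refl
  UnderHull-card (suc n) S rewrite card-slices S | card-slices (boundary S) =
    UnderHull-step (card ∘ slice S) (card ∘ boundary ∘ slice S) (card ∘ slice (boundary S))
      (card≤ ∘ boundary ∘ slice S) (UnderHull-card n ∘ slice S)
      (λ i j i≢j → card-mono {n = n} (boundary-slice⊆ {S = S} i≢j))

  UnderHull⇒bound : ∀ {a b M} p → UnderHull a b M → t ^ p * b ≤ w ^ p * M → t ^ p * a ≤ M
  UnderHull⇒bound {a} {b} {M} p hull left = *-cancelˡ-≤ (w ^ p) {{m^n≢0 w p}} (begin
    w ^ p * (t ^ p * a)  ≡⟨ rotate (w ^ p) (t ^ p) a ⟩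
    t ^ p * (a * w ^ p)  ≤⟨ *-monoʳ-≤ (t ^ p) (UnderHull⇒ray {p} (atMost left) hull) ⟩
    t ^ p * b            ≤⟨ left ⟩
    w ^ p * M            ∎)
    where
      open ≤-Reasoning
      rotate : ∀ x y z → x * (y * z) ≡ y * (z * x)
      rotate = solve-∀

-- The argument works for every t ≥ 2.
lemma2p7 : ∀ (n t : ℕ) → 1 ≤ n → 3 ≤ t → (S : Subset t n) →
    EtaBound t (t ^ n) (card S) (card (boundary S))
lemma2p7 n _ _ (s≤s (s≤s (s≤s {n = d} _))) S p q _ bound =
  subst₂ (λ a N → t ^ p * a ≤ N) (card-^⊗ S q) t^qn≡[t^n]^q
    (UnderHull⇒bound p (UnderHull-card (q * n) (S ^⊗ q))
      (subst₂ (λ b N → t ^ p * b ≤ w ^ p * N) (sym (card-boundary-^⊗ S q)) (sym t^qn≡[t^n]^q) bound))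
  where
    open Hull (suc d)
    t^qn≡[t^n]^q : t ^ (q * n) ≡ (t ^ n) ^ q
    t^qn≡[t^n]^q = trans (cong (t ^_) (*-comm q n)) (sym (^-*-assoc t n q))
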